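{- For every term type $\delta$ and stack type $\kappa$: (1) $[\![\delta]\!]\subseteq\mathcal{SN}$ and $[\![\kappa]\!]\subseteq\mathcal{SN}^*$; (2) for every term variable $x$ and stack $\vec N$, if $x\vec N\in\mathcal{SN}$ then $x\vec N\in[\![\delta]\!]$; (3) for every $n\ge|\kappa|$, every stack of term variables $x_1{:}\cdots{:}x_n$ belongs to $[\![\kappa]\!]$.
   Context: Pure $\lambda\mu$-calculus: terms $M,N ::= x \mid \lambda x.M \mid MN \mid \mu\alpha.C$, commands $C ::= [\alpha]M$; reduction is the compatible closure of $(\lambda x.M)N\to M[N/x]$ and $(\mu\beta.C)N\to\mu\beta.(C[\beta\Leftarrow N])$, where $C[\beta\Leftarrow N]$ replaces every subcommand $[\beta]P$ by $[\beta](P[\beta\Leftarrow N])N$. $\mathcal{SN}$ is the set of strongly normalising terms. A stack is a finite (possibly empty) sequence $\vec L=L_1{:}\cdots{:}L_k$ of terms, $M\vec L=ML_1\cdots L_k$, and $N{:}\vec L$ is the stack with $N$ prepended; $\mathcal{SN}^*$ is the set of finite stacks of terms in $\mathcal{SN}$. Types: with a single constant $\nu$ and a symbol $\omega$ (not itself a type), term types $\delta ::= \nu \mid \omega\to\nu \mid \kappa\to\nu \mid \delta\wedge\delta$ and stack types $\kappa ::= \delta\times\omega \mid \delta\times\kappa \mid \kappa\wedge\kappa$. Interpretation: $[\![\nu]\!]=[\![\omega\to\nu]\!]=\mathcal{SN}$; $[\![\kappa\to\nu]\!]=\{M\mid \forall\vec L\in[\![\kappa]\!],\ M\vec L\in\mathcal{SN}\}$;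 $[\![\delta\times\omega]\!]=\{N{:}\vec L\mid N\in[\![\delta]\!],\vec L\in\mathcal{SN}^*\}$; $[\![\delta\times\kappa]\!]=\{N{:}\vec L\mid N\in[\![\delta]\!],\vec L\in[\![\kappa]\!]\}$; $[\![\sigma\wedge\tau]\!]=[\![\sigma]\!]\cap[\![\tau]\!]$. Length: $|\delta\times\omega|=1$, $|\delta\times\kappa|=1+|\kappa|$, $|\kappa_1\wedge\kappa_2|=\max(|\kappa_1|,|\kappa_2|)$. -}

module Defs where

open import Data.Nat using (ℕ; zero; suc; _≟_; _⊔_)
open import Data.List using (List; []; _∷_; foldl)
open import Data.List.Relation.Unary.All using (All)
open import Data.Product using (_×_)
open import Data.Empty using (⊥)
open import Relation.Nullary using (yes; no)
open import Induction.WellFounded using (Acc)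

-- Pure λμ-calculus, de Bruijn style with two separate kinds of indices:
-- term variables (bound by λ) and names / μ-variables (bound by μ).

mutual
  data Term : Set where
    var : ℕ → Term
    lam : Term → Term
    app : Term → Term → Term
    mu  : Cmd → Term

  data Cmd : Set where
    name : ℕ → Term → Cmd

mutual
  renT : (ℕ → ℕ) → Term → Term
  renT ρ (var x)   = var (ρ x)
  renT ρ (lam M)   = lam (renT (liftR ρ) M)
  renT ρ (app M N) = app (renT ρ M) (renT ρ N)
  renT ρ (mu C)    = mu (renTC ρ C)

  renTC : (ℕ → ℕ) → Cmd → Cmd
  renTC ρ (name α M) = name α (renT ρ M)

  liftR : (ℕ → ℕ) → ℕ → ℕ
  liftR ρ zero    = zero
  liftR ρ (suc n) = suc (ρ n)

mutual
  renN : (ℕ → ℕ) → Term → Term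
  renN ρ (var x)   = var x
  renN ρ (lam M)   = lam (renN ρ M)
  renN ρ (app M N) = app (renN ρ M) (renN ρ N)
  renN ρ (mu C)    = mu (renNC (liftR ρ) C)

  renNC : (ℕ → ℕ) → Cmd → Cmd
  renNC ρ (name α M) = name (ρ α) (renN ρ M)

exts : (ℕ → Term) → ℕ → Term
exts σ zero    = var zero
exts σ (suc n) = renT suc (σ n)

extsN : (ℕ → Term) → ℕ → Term
extsN σ n = renN suc (σ n)

mutual
  sub : (ℕ → Term) → Term → Term
  sub σ (var x)   = σ x
  sub σ (lam M)   = lam (sub (exts σ) M)
  sub σ (app M N) = app (sub σ M) (sub σ N)
  sub σ (mu C)    = mu (subC (extsN σ) C)

  subC : (ℕ → Term) → Cmd → Cmd
  subC σ (name α M) = name α (sub σ M)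

single : Term → ℕ → Term
single N zero    = N
single N (suc n) = var n

_[_/0] : Term → Term → Term
M [ N /0] = sub (single N) M

-- structural substitution  C[β ⇐ N]: every [β]P becomes [β](P[β⇐N])N
mutual
  ssub : ℕ → Term → Term → Term
  ssub β N (var x)   = var x
  ssub β N (lam M)   = lam (ssub β (renT suc N) M)
  ssub β N (app M P) = app (ssub β N M) (ssub β N P)
  ssub β N (mu C)    = mu (ssubC (suc β) (renN suc N) C)

  ssubC : ℕ → Term → Cmd → Cmd
  ssubC β N (name α M) with α ≟ β
  ... | yes _ = name α (app (ssub β N M) N)
  ... | no  _ = name α (ssub β N M)

mutual
  infix 4 _⟶_ _⟶C_
  data _⟶_ : Term → Term → Set where
    βred  : ∀ {M N} → app (lam M) N ⟶ M [ N /0]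
    μred  : ∀ {C N} → app (mu C) N ⟶ mu (ssubC zero (renN suc N) C)
    ξlam  : ∀ {M M'} → M ⟶ M' → lam M ⟶ lam M'
    ξappl : ∀ {M M' N} → M ⟶ M' → app M N ⟶ app M' N
    ξappr : ∀ {M N N'} → N ⟶ N' → app M N ⟶ app M N'
    ξmu   : ∀ {C C'} → C ⟶C C' → mu C ⟶ mu C'

  data _⟶C_ : Cmd → Cmd → Set where
    ξname : ∀ {α M M'} → M ⟶ M' → name α M ⟶C name α M'

SN : Term → Set
SN = Acc (λ N M → M ⟶ N)

Stack : Set
Stack = List Term

_·_ : Term → Stack → Term
M · L = foldl app M L

SN* : Stack → Set
SN* = All SN

mutual
  data TType : Set where
    ν     : TType
    ω⇒ν   : TType
    _⇒ν   : SType → TType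
    _∧_   : TType → TType → TType

  data SType : Set where
    _⊗ω   : TType → SType
    _⊗_   : TType → SType → SType
    _∧ˢ_  : SType → SType → SType

mutual
  ⟦_⟧ : TType → Term → Set
  ⟦ ν ⟧ M       = SN M
  ⟦ ω⇒ν ⟧ M     = SN M
  ⟦ κ ⇒ν ⟧ M    = ∀ (L : Stack) → ⟦ κ ⟧ˢ L → SN (M · L)
  ⟦ δ₁ ∧ δ₂ ⟧ M = ⟦ δ₁ ⟧ M × ⟦ δ₂ ⟧ M

  ⟦_⟧ˢ : SType → Stack → Set
  ⟦ δ ⊗ω ⟧ˢ []        = ⊥
  ⟦ δ ⊗ω ⟧ˢ (N ∷ L)   = ⟦ δ ⟧ N × SN* L
  ⟦ δ ⊗ κ ⟧ˢ []       = ⊥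
  ⟦ δ ⊗ κ ⟧ˢ (N ∷ L)  = ⟦ δ ⟧ N × ⟦ κ ⟧ˢ L
  ⟦ κ₁ ∧ˢ κ₂ ⟧ˢ L     = ⟦ κ₁ ⟧ˢ L × ⟦ κ₂ ⟧ˢ L

∣_∣ : SType → ℕ
∣ δ ⊗ω ∣     = 1
∣ δ ⊗ κ ∣    = suc ∣ κ ∣
∣ κ₁ ∧ˢ κ₂ ∣ = ∣ κ₁ ∣ ⊔ ∣ κ₂ ∣

-- A neutral
-- term x N₁ ⋯ Nₖ can only reduce inside its arguments, so it is strongly
-- normalising as soon as they are, and then it inhabits every ⟦ δ ⟧: for
-- κ ⇒ν its application to a stack in ⟦ κ ⟧ˢ ⊆ SN* is again neutral with SN
-- arguments.  Hence long enough stacks of variables inhabit every ⟦ κ ⟧ˢ, and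
-- applying M ∈ ⟦ κ ⇒ν ⟧ to one of them yields an SN term with head M.
module Submission where

open import Defs
open import Data.Nat using (ℕ; _≤_; s≤s)
open import Data.Nat.Properties using (≤-reflexive; m⊔n≤o⇒m≤o; m⊔n≤o⇒n≤o)
open import Data.List using (List; []; _∷_; map; length; replicate)
open import Data.List.Properties using (length-replicate)
open import Data.List.Relation.Unary.All using ([]; _∷_; universal)
open import Data.List.Relation.Unary.All.Properties using (map⁺)
open import Data.Product using (_×_; _,_; proj₁)
open import Relation.Binary.PropositionalEquality using (_≡_; refl; sym)
open import Induction.WellFounded using (acc)

SN-appˡ : ∀ {M N} → SN (app M N) → SN M
SN-appˡ (acc rs) = acc λ s → SN-appˡ (rs (ξappl s))

SN-appʳ : ∀ {M N} → SN (app M N) → SN N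
SN-appʳ (acc rs) = acc λ s → SN-appʳ (rs (ξappr s))

SN-·-head : ∀ M L → SN (M · L) → SN M
SN-·-head M []      h = h
SN-·-head M (N ∷ L) h = SN-appˡ (SN-·-head (app M N) L h)

SN-·-stack : ∀ M L → SN (M · L) → SN* L
SN-·-stack M []      h = []
SN-·-stack M (N ∷ L) h = SN-appʳ (SN-·-head (app M N) L h) ∷ SN-·-stack (app M N) L h

SN-var : ∀ x → SN (var x)
SN-var x = acc λ ()

SN*-vars : ∀ xs → SN* (map var xs)
SN*-vars xs = map⁺ (universal SN-var xs)

data Neutral : Term → Set where
  var : ∀ {x} → Neutral (var x)
  app : ∀ {P N} → Neutral P → Neutral (app P N)

Neutral-· : ∀ {P} → Neutral P → ∀ L → Neutral (P · L)
Neutral-· nP []      = nP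
Neutral-· nP (N ∷ L) = Neutral-· (app nP) L

Neutral-⟶ : ∀ {P P'} → Neutral P → P ⟶ P' → Neutral P'
Neutral-⟶ (app ()) βred
Neutral-⟶ (app ()) μred
Neutral-⟶ (app nP) (ξappl s) = app (Neutral-⟶ nP s)
Neutral-⟶ (app nP) (ξappr s) = app nP

mutual
  SN-app-neutral : ∀ {P N} → Neutral P → SN P → SN N → SN (app P N)
  SN-app-neutral nP sP sN = acc (app-neutral-reduct-SN nP sP sN)

  app-neutral-reduct-SN : ∀ {P N} → Neutral P → SN P → SN N → ∀ {Q} → app P N ⟶ Q → SN Q
  app-neutral-reduct-SN ()  _          _          βred
  app-neutral-reduct-SN ()  _          _          μred
  app-neutral-reduct-SN nP  (acc rsP)  sN         (ξappl s) = SN-app-neutral (Neutral-⟶ nP s) (rsP s) sN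
  app-neutral-reduct-SN nP  sP         (acc rsN)  (ξappr s) = SN-app-neutral nP sP (rsN s)

SN-·-neutral : ∀ {P} → Neutral P → SN P → ∀ {L} → SN* L → SN (P · L)
SN-·-neutral nP sP []         = sP
SN-·-neutral nP sP (sN ∷ sNs) = SN-·-neutral (app nP) (SN-app-neutral nP sP sN) sNs

mutual
  ⟦⟧⇒SN : ∀ δ M → ⟦ δ ⟧ M → SN M
  ⟦⟧⇒SN ν         M h = h
  ⟦⟧⇒SN ω⇒ν       M h = h
  ⟦⟧⇒SN (κ ⇒ν)    M h = SN-·-head M (map var xs) (h (map var xs) (vars∈⟦⟧ˢ κ xs long))
    where
    xs : List ℕ
    xs = replicate ∣ κ ∣ 0

    long : ∣ κ ∣ ≤ length xs
    long = ≤-reflexive (sym (length-replicate ∣ κ ∣))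
  ⟦⟧⇒SN (δ₁ ∧ δ₂) M h = ⟦⟧⇒SN δ₁ M (proj₁ h)

  ⟦⟧ˢ⇒SN* : ∀ κ L → ⟦ κ ⟧ˢ L → SN* L
  ⟦⟧ˢ⇒SN* (δ ⊗ω)      (N ∷ L) (hN , hL) = ⟦⟧⇒SN δ N hN ∷ hL
  ⟦⟧ˢ⇒SN* (δ ⊗ κ)     (N ∷ L) (hN , hL) = ⟦⟧⇒SN δ N hN ∷ ⟦⟧ˢ⇒SN* κ L hL
  ⟦⟧ˢ⇒SN* (κ₁ ∧ˢ κ₂)  L       h         = ⟦⟧ˢ⇒SN* κ₁ L (proj₁ h)

  neutral-SN⇒⟦⟧ : ∀ δ {P} → Neutral P → SN P → ⟦ δ ⟧ P
  neutral-SN⇒⟦⟧ ν         nP sP = sP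
  neutral-SN⇒⟦⟧ ω⇒ν       nP sP = sP
  neutral-SN⇒⟦⟧ (κ ⇒ν)    nP sP = λ L hL → SN-·-neutral nP sP (⟦⟧ˢ⇒SN* κ L hL)
  neutral-SN⇒⟦⟧ (δ₁ ∧ δ₂) nP sP = neutral-SN⇒⟦⟧ δ₁ nP sP , neutral-SN⇒⟦⟧ δ₂ nP sP

  vars∈⟦⟧ˢ : ∀ κ xs → ∣ κ ∣ ≤ length xs → ⟦ κ ⟧ˢ (map var xs)
  vars∈⟦⟧ˢ (δ ⊗ω)     (x ∷ xs) _         = neutral-SN⇒⟦⟧ δ var (SN-var x) , SN*-vars xs
  vars∈⟦⟧ˢ (δ ⊗ κ)    (x ∷ xs) (s≤s le)  = neutral-SN⇒⟦⟧ δ var (SN-var x) , vars∈⟦⟧ˢ κ xs le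
  vars∈⟦⟧ˢ (κ₁ ∧ˢ κ₂) xs       le        =
    vars∈⟦⟧ˢ κ₁ xs (m⊔n≤o⇒m≤o ∣ κ₁ ∣ ∣ κ₂ ∣ le) , vars∈⟦⟧ˢ κ₂ xs (m⊔n≤o⇒n≤o ∣ κ₁ ∣ ∣ κ₂ ∣ le)

lemma2p12 : (δ : TType) (κ : SType) →
    ((∀ (M : Term) → ⟦ δ ⟧ M → SN M) × (∀ (L : Stack) → ⟦ κ ⟧ˢ L → SN* L))
    × (∀ (x : ℕ) (Ns : Stack) → SN (var x · Ns) → ⟦ δ ⟧ (var x · Ns))
    × (∀ (n : ℕ) → ∣ κ ∣ ≤ n → ∀ (xs : List ℕ) → length xs ≡ n → ⟦ κ ⟧ˢ (map var xs))
lemma2p12 δ κ =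
  (⟦⟧⇒SN δ , ⟦⟧ˢ⇒SN* κ)
  , (λ x Ns → neutral-SN⇒⟦⟧ δ (Neutral-· var Ns))
  , (λ { n le xs refl → vars∈⟦⟧ˢ κ xs le })
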